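{- The schema $\langle\![G\cup H]\!\rangle\varphi\to\langle\![G]\!\rangle\langle\![H]\!\rangle\varphi$ is not valid: there exist a finite set of agents $A$, subsets $G,H\subseteq A$, and a formula $\varphi\in\mathcal{L}_{CoGAL}$ such that $\langle\![G\cup H]\!\rangle\varphi\to\langle\![G]\!\rangle\langle\![H]\!\rangle\varphi$ is false at some pointed epistemic model.
   Context: Given a finite set of agents $A$ and a countable set $P$ of propositional variables, the language $\mathcal{L}_{CoGAL}$ is given by $\varphi ::= p \mid \neg\varphi \mid (\varphi\wedge\varphi) \mid K_a\varphi \mid [\varphi]\varphi \mid [G]\varphi \mid [\!\langle G\rangle\!]\varphi$ with $p\in P$, $a\in A$, $G\subseteq A$; usual propositional abbreviations; duals $\langle\varphi\rangle\psi=\neg[\varphi]\neg\psi$, $\langle\![G]\!\rangle\varphi=\neg[\!\langle G\rangle\!]\neg\varphi$. $\mathcal{L}_{EL}$ is the fragment built from $p,\neg,\wedge,K_a$ only. For $G\subseteq A$, $\mathcal{L}_{EL}^G$ is the set of formulas $\bigwedge_{i\in G}K_i\varphi_i$ with each $\varphi_i\in\mathcal{L}_{EL}$. An epistemic model is $M=(W,\sim,V)$ with $W\neq\emptyset$, $\sim_a$ an equivalence relation on $W$ for each $a$, $V:P\to\mathcal P(W)$. Semantics at $(M,w)$: $p$ iff $w\in V(p)$; Boolean clauses as usual; $K_a\varphi$ iff $(M,v)\models\varphi$ for all $v$ with $w\sim_a v$; $[\varphi]\psi$ iff $(M,w)\models\varphi$ implies $(M^\varphi,w)\models\psi$, where $M^\varphi$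 is the restriction of $M$ to $\llbracket\varphi\rrbracket_M=\{v:(M,v)\models\varphi\}$; $[G]\varphi$ iff for all $\psi\in\mathcal{L}_{EL}^G$, $(M,w)\models[\psi]\varphi$; $[\!\langle G\rangle\!]\varphi$ iff for all $\psi\in\mathcal{L}_{EL}^G$ there is $\chi\in\mathcal{L}_{EL}^{A\setminus G}$ with $(M,w)\models\psi\to\langle\psi\wedge\chi\rangle\varphi$. Consequently $(M,w)\models\langle\![G]\!\rangle\varphi$ iff there is $\psi\in\mathcal{L}_{EL}^G$ such that for all $\chi\in\mathcal{L}_{EL}^{A\setminus G}$, $(M,w)\models\psi\wedge[\psi\wedge\chi]\varphi$. -}

module Defs where

open import Data.Nat using (ℕ)
open import Data.Fin using (Fin)
open import Data.Fin.Subset using (Subset; _∈_; _∪_; ∁)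
open import Data.Product using (Σ; _×_; _,_; proj₁)
open import Relation.Nullary using (¬_)
open import Relation.Binary.Structures using (IsEquivalence)

data ELForm (n : ℕ) : Set where
  elVar : ℕ → ELForm n
  elNeg : ELForm n → ELForm n
  elAnd : ELForm n → ELForm n → ELForm n
  elK   : Fin n → ELForm n → ELForm n

data Form (n : ℕ) : Set where
  var  : ℕ → Form n
  neg  : Form n → Form n
  and  : Form n → Form n → Form n
  K    : Fin n → Form n → Form n
  ann  : Form n → Form n → Form n
  box  : Subset n → Form n → Form n
  coal : Subset n → Form n → Form n

imp : ∀ {n} → Form n → Form n → Form n
imp φ ψ = neg (and φ (neg ψ))

dcoal : ∀ {n} → Subset n → Form n → Form n
dcoal G φ = neg (coal G (neg φ))

record Model (n : ℕ) : Set₁ where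
  field
    W     : Set
    R     : Fin n → W → W → Set
    R-eq  : (a : Fin n) → IsEquivalence (R a)
    V     : ℕ → W → Set
open Model public

restrict : ∀ {n} (M : Model n) → (W M → Set) → Model n
restrict M P = record
  { W    = Σ (W M) P
  ; R    = λ a u v → R M a (proj₁ u) (proj₁ v)
  ; R-eq = λ a → record
      { refl  = IsEquivalence.refl (R-eq M a)
      ; sym   = IsEquivalence.sym (R-eq M a)
      ; trans = IsEquivalence.trans (R-eq M a) }
  ; V    = λ p u → V M p (proj₁ u)
  }

elSat : ∀ {n} (M : Model n) → W M → ELForm n → Set
elSat M w (elVar p)   = V M p w
elSat M w (elNeg φ)   = ¬ elSat M w φ
elSat M w (elAnd φ ψ) = elSat M w φ × elSat M w ψ
elSat M w (elK a φ)   = (v : W M) → R M a w v → elSat M v φ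

-- A formula of L_EL^G, ⋀_{i∈G} K_i φ_i, is given by the family (φ_i)_{i∈G};
-- we represent it as a function Fin n → ELForm n whose values outside G are
-- irrelevant.
elGSat : ∀ {n} (M : Model n) → Subset n → (Fin n → ELForm n) → W M → Set
elGSat {n} M G f w = (i : Fin n) → i ∈ G → elSat M w (elK i (f i))

sat : ∀ {n} (M : Model n) → W M → Form n → Set
sat M w (var p)    = V M p w
sat M w (neg φ)    = ¬ sat M w φ
sat M w (and φ ψ)  = sat M w φ × sat M w ψ
sat M w (K a φ)    = (v : W M) → R M a w v → sat M v φ
sat M w (ann φ ψ)  =
  (h : sat M w φ) → sat (restrict M (λ v → sat M v φ)) (w , h) ψ
sat M w (box G φ)  =
  (f : Fin _ → ELForm _) → (h : elGSat M G f w) →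
  sat (restrict M (elGSat M G f)) (w , h) φ
sat M w (coal G φ) =
  (f : Fin _ → ELForm _) → Σ (Fin _ → ELForm _) λ g →
  (h : elGSat M G f w) →
  Σ (elGSat M (∁ G) g w) λ k →
  sat (restrict M (λ v → elGSat M G f v × elGSat M (∁ G) g v)) (w , (h , k)) φ

-- Two worlds, p true at only one of them; agent a cannot tell them apart, agent b can.
-- Let φ = p ∧ ¬K_a p. The coalition {b} secures φ by saying nothing: whatever a
-- answers is a K_a-formula, hence true at both worlds, so the ¬p-world survives and
-- a stays ignorant. The empty coalition cannot secure ⟨[{b}]⟩φ, because the opponents
-- {a, b} may answer K_b p, which removes the ¬p-world; in any model where p holds
-- everywhere, a knows p and φ is refuted by every announcement.
module Submission where

open import Defs
open import Data.Bool using (Bool; true; false)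
open import Data.Fin using (Fin; zero; suc)
open import Data.Fin.Subset using (Subset; _∈_; _∪_; ∁; ⊥; ⁅_⁆)
open import Data.Nat using (ℕ)
open import Data.Product using (Σ; _×_; _,_)
open import Data.Unit using (⊤; tt)
open import Data.Vec.Base using (here; there)
open import Relation.Binary.PropositionalEquality using (_≡_; refl; sym; isEquivalence)
open import Relation.Binary.Structures using (IsEquivalence)
open import Relation.Nullary using (¬_)

module _ {n : ℕ} (M : Model n) where

  private
    module R (a : Fin n) = IsEquivalence (R-eq M a)

  elTrue : ELForm n
  elTrue = elNeg (elAnd (elVar 0) (elNeg (elVar 0)))

  elSat-elTrue : ∀ w → elSat M w elTrue
  elSat-elTrue _ (p , ¬p) = ¬p p

  trueFamily : Fin n → ELForm n
  trueFamily _ = elTrue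

  elGSat-trueFamily : ∀ {G w} → elGSat M G trueFamily w
  elGSat-trueFamily _ _ u _ = elSat-elTrue u

  elK-transfer : ∀ {a φ w v} → R M a w v → elSat M w (elK a φ) → elSat M v (elK a φ)
  elK-transfer {a} w∼v Kφ u v∼u = Kφ u (R.trans a w∼v v∼u)

  elGSat-transfer : ∀ {G f w v} → (∀ i → i ∈ G → R M i w v) →
                    elGSat M G f w → elGSat M G f v
  elGSat-transfer {f = f} w∼v ψ i i∈G = elK-transfer {φ = f i} (w∼v i i∈G) (ψ i i∈G)

  dcoal-intro : ∀ {G φ w} (f : Fin n → ELForm n) (h : elGSat M G f w) →
    ((g : Fin n → ELForm n) (k : elGSat M (∁ G) g w) →
       sat (restrict M (λ v → elGSat M G f v × elGSat M (∁ G) g v)) (w , (h , k)) φ) →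
    sat M w (dcoal G φ)
  dcoal-intro f h secures blocks with blocks f
  ... | g , respond with respond h
  ... | k , ¬φ = ¬φ (secures g k)

  refute-imp : ∀ {φ ψ w} → sat M w φ → ¬ sat M w ψ → ¬ sat M w (imp φ ψ)
  refute-imp φ ¬ψ ¬[φ∧¬ψ] = ¬[φ∧¬ψ] (φ , ¬ψ)

unknownTruth : ∀ {n} → Fin n → ℕ → Form n
unknownTruth a p = and (var p) (neg (K a (var p)))

Valid : ∀ {n} → Model n → ℕ → Set
Valid M p = ∀ w → V M p w

Valid-restrict : ∀ {n p} (M : Model n) (P : W M → Set) → Valid M p → Valid (restrict M P) p
Valid-restrict M P valid (w , _) = valid w

Valid-¬unknownTruth : ∀ {n p a} (M : Model n) → Valid M p → ∀ w → ¬ sat M w (unknownTruth a p)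
Valid-¬unknownTruth M valid w (_ , ¬Kp) = ¬Kp (λ v _ → valid v)

Valid-coal-¬unknownTruth : ∀ {n p a G} (M : Model n) → Valid M p →
                           ∀ w → sat M w (coal G (neg (unknownTruth a p)))
Valid-coal-¬unknownTruth {a = a} {G} M valid w f =
  trueFamily M , λ h → elGSat-trueFamily M ,
    Valid-¬unknownTruth {a = a} (restrict M announced) (Valid-restrict M announced valid)
      (w , h , elGSat-trueFamily M)
  where
  announced : W M → Set
  announced v = elGSat M G f v × elGSat M (∁ G) (trueFamily M) v

blind sighted : Fin 2
blind   = zero
sighted = suc zero

indist : Fin 2 → Bool → Bool → Set
indist zero    _ _ = ⊤
indist (suc _) u v = u ≡ v

indist-isEquivalence : (a : Fin 2) → IsEquivalence (indist a)
indist-isEquivalence zero    = record { refl = tt ; sym = λ _ → tt ; trans = λ _ _ → tt }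
indist-isEquivalence (suc _) = isEquivalence

twoWorlds : Model 2
twoWorlds = record { W = Bool ; R = indist ; R-eq = indist-isEquivalence ; V = λ _ w → w ≡ true }

indist-outside-sighted : ∀ i → i ∈ ∁ ⁅ sighted ⁆ → indist i true false
indist-outside-sighted zero       _          = tt
indist-outside-sighted (suc zero) (there ())

sighted-secures-unknownTruth : sat twoWorlds true (dcoal ⁅ sighted ⁆ (unknownTruth blind 0))
sighted-secures-unknownTruth =
  dcoal-intro twoWorlds {φ = unknownTruth blind 0}
    (trueFamily twoWorlds) (elGSat-trueFamily twoWorlds) λ g k →
      refl , λ Kp → false≢true (Kp (false , elGSat-trueFamily twoWorlds ,
                                     elGSat-transfer twoWorlds {f = g} indist-outside-sighted k) tt)
  where
  false≢true : ¬ false ≡ true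
  false≢true ()

sighted-knows-p : Fin 2 → ELForm 2
sighted-knows-p zero    = elTrue twoWorlds
sighted-knows-p (suc _) = elVar 0

sighted-knows-p-at-true : elGSat twoWorlds (∁ ⊥) sighted-knows-p true
sighted-knows-p-at-true zero       _ u _  = elSat-elTrue twoWorlds u
sighted-knows-p-at-true (suc zero) _ _ eq = sym eq

empty-blocks-unknownTruth :
  sat twoWorlds true (coal ⊥ (neg (dcoal ⁅ sighted ⁆ (unknownTruth blind 0))))
empty-blocks-unknownTruth f =
  sighted-knows-p , λ h → sighted-knows-p-at-true , λ ¬blocks →
    ¬blocks (Valid-coal-¬unknownTruth {p = 0} {blind} {⁅ sighted ⁆}
               (restrict twoWorlds announced) p-valid (true , h , sighted-knows-p-at-true))
  where
  announced : Bool → Set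
  announced v = elGSat twoWorlds ⊥ f v × elGSat twoWorlds (∁ ⊥) sighted-knows-p v

  p-valid : Valid (restrict twoWorlds announced) 0
  p-valid (v , _ , knows) = knows sighted (there here) v refl

proposition4 : Σ ℕ λ n → Σ (Subset n) λ G → Σ (Subset n) λ H → Σ (Form n) λ φ →
    Σ (Model n) λ M → Σ (W M) λ w →
      ¬ sat M w (imp (dcoal (G ∪ H) φ) (dcoal G (dcoal H φ)))
-- Here G ∪ H = ⊥ ∪ ⁅ sighted ⁆ computes to ⁅ sighted ⁆.
proposition4 =
  2 , ⊥ , ⁅ sighted ⁆ , φ , twoWorlds , true ,
  refute-imp twoWorlds {dcoal ⁅ sighted ⁆ φ} {dcoal ⊥ (dcoal ⁅ sighted ⁆ φ)}
    sighted-secures-unknownTruth (λ ¬blocks → ¬blocks empty-blocks-unknownTruth)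
  where
  φ : Form 2
  φ = unknownTruth blind 0
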